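{- Let $a\le 0$ be an integer. Define $b_{\mathcal{M}}(n)$, $n\ge0$, by $b_{\mathcal{M}}(0)=1$, $b_{\mathcal{M}}(1)=-1$, $b_{\mathcal{M}}(2)=a$ and, for $n\ge3$, $b_{\mathcal{M}}(n)=-\frac{1}{2}\sum_{k=0}^{n-1}b_{\mathcal{M}}(k)\binom{n+1}{k+1}$. For integers $0\le j\le d$ set $s_{\mathcal{M}}(j,d)=\sum_{k=j}^d\frac{1}{k+1}\binom{d-j}{d-k}b_{\mathcal{M}}(k)$. Then for all $m\ge1$: $$0=s_{\mathcal{M}}(0,4m)\le s_{\mathcal{M}}(1,4m)\le\cdots\le s_{\mathcal{M}}(2m,4m),$$ $$0\le s_{\mathcal{M}}(2m,4m+1)\le s_{\mathcal{M}}(2m-1,4m+1)\le\cdots\le s_{\mathcal{M}}(0,4m+1),$$ $$0=s_{\mathcal{M}}(0,4m+2)\ge s_{\mathcal{M}}(1,4m+2)\ge\cdots\ge s_{\mathcal{M}}(2m+1,4m+2),$$ $$0\ge s_{\mathcal{M}}(2m+1,4m+3)\ge s_{\mathcal{M}}(2m,4m+3)\ge\cdots\ge s_{\mathcal{M}}(0,4m+3).$$ -}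

module Defs where

open import Data.Nat as ℕ using (ℕ; zero; suc; _∸_)
open import Data.Nat.Combinatorics using (_C_)
open import Data.Integer as ℤ using (ℤ; +_)
open import Data.Rational as ℚ using (ℚ; 0ℚ; 1ℚ; _+_; _*_; _/_; -_)
open import Data.List using (List; []; _∷_; _++_; [_]; foldr; length; zip; upTo; map)
open import Data.Product using (_,_)

ℕtoℚ : ℕ → ℚ
ℕtoℚ n = (+ n) / 1

Σℚ : List ℚ → ℚ
Σℚ = foldr _+_ 0ℚ

next : ℕ → List ℚ → ℚ
next n prev =
  ℚ.- ((+ 1 / 2) * Σℚ (map (λ { (k , bk) → bk * ℕtoℚ (suc n C suc k) })
                            (zip (upTo n) prev)))

-- bsUpTo a n = [b(0), b(1), …, b(n)]
bsUpTo : ℤ → ℕ → List ℚ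
bsUpTo a zero = 1ℚ ∷ []
bsUpTo a (suc zero) = 1ℚ ∷ ℚ.- 1ℚ ∷ []
bsUpTo a (suc (suc zero)) = 1ℚ ∷ ℚ.- 1ℚ ∷ (a / 1) ∷ []
bsUpTo a (suc (suc (suc n))) =
  let prev = bsUpTo a (suc (suc n)) in prev ++ [ next (suc (suc (suc n))) prev ]

lastOr : ℚ → List ℚ → ℚ
lastOr d [] = d
lastOr d (x ∷ xs) = lastOr x xs

bM : ℤ → ℕ → ℚ
bM a n = lastOr 0ℚ (bsUpTo a n)

sM : ℤ → ℕ → ℕ → ℚ
sM a j d =
  Σℚ (map (λ i → let k = j ℕ.+ i in
                 ((+ 1) / suc k) * ℕtoℚ ((d ∸ j) C (d ∸ k)) * bM a k)
          (upTo (suc (d ∸ j))))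

-- The triangle sM a j d is the binomial transform, shifted by j, of the sequence
-- k ↦ bM a k / (k + 1); hence it obeys Pascal's rule s(j, d+1) = s(j, d) + s(j+1, d+1).
-- Absorbing 1/(k+1) into the binomial coefficient turns the recurrence for b(d) into the
-- reflection s(0, d) = -s(d, d), and reflection plus Pascal's rule make every even row
-- symmetric and every odd row antisymmetric about its middle.  So s(0, d) = 0 for even
-- d ≥ 4, and the middle entry of an odd row is half the entry above it.  Signs then
-- propagate down the rows with period four: by Pascal's rule a row that is nonpositive
-- (nonnegative) on its left half makes the next row increasing (decreasing) there.  The
-- induction starts from row 2, where s(0, 2) = s(2, 2) = a/3 ≤ 0 and
-- s(1, 2) = -1/2 + a/3 ≤ 0; this is the only place where a ≤ 0 is used.

module Submission where

open import Data.Nat as ℕ using (ℕ; zero; suc; _∸_; z≤n; s≤s)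
open import Data.Nat.Properties as ℕP using (+-suc; m≤m+n; m≤n+m)
open import Data.Nat.Combinatorics using (_C_; nCk≡nC[n∸k]; nCk+nC[k+1]≡[n+1]C[k+1]; k>n⇒nCk≡0; nCn≡1; nC1≡n)
import Data.Nat.Tactic.RingSolver as ℕSolver
open import Data.Integer as ℤ using (ℤ; +_; +0; +[1+_]; -[1+_])
import Data.Integer.Properties as ℤP
import Data.Integer.Tactic.RingSolver as ℤSolver
open import Data.Rational as ℚ using (ℚ; 0ℚ; 1ℚ; ½; _+_; _*_; _/_; -_; _-_; _≤_; toℚᵘ; fromℚᵘ)
open import Data.Rational.Properties as ℚP using (toℚᵘ-injective; toℚᵘ-fromℚᵘ; toℚᵘ-homo-+; toℚᵘ-homo-*; fromℚᵘ-cong)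
open import Data.Rational.Unnormalised as ℚᵘ using (mkℚᵘ; *≡*)
import Data.Rational.Unnormalised.Properties as ℚᵘP
open import Data.Rational.Solver using (module +-*-Solver)
open import Data.List using (_∷_; []; applyUpTo; upTo; map; zip; _∷ʳ_)
open import Data.List.Properties using (map-applyUpTo; applyUpTo-∷ʳ)
open import Data.Product using (_×_; _,_; proj₁; proj₂)
open import Data.Sum using (inj₁; inj₂)
open import Level using (0ℓ)
open import Relation.Binary.Core using (Rel)
open import Relation.Binary.Definitions using (Reflexive; Transitive)
open import Function using (_∘_; flip)
open import Relation.Binary.PropositionalEquality
open import Defs

open +-*-Solver

-- ℕtoℚ n is fromℚᵘ (mkℚᵘ (+ n) 0) by definition, so its arithmetic is done in ℚᵘ.

fromℚᵘ-homo-+ : ∀ p q → fromℚᵘ (p ℚᵘ.+ q) ≡ fromℚᵘ p + fromℚᵘ q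
fromℚᵘ-homo-+ p q = toℚᵘ-injective (begin
  toℚᵘ (fromℚᵘ (p ℚᵘ.+ q))               ≈⟨ toℚᵘ-fromℚᵘ _ ⟩
  p ℚᵘ.+ q                               ≈⟨ ℚᵘP.+-cong (toℚᵘ-fromℚᵘ p) (toℚᵘ-fromℚᵘ q) ⟨
  toℚᵘ (fromℚᵘ p) ℚᵘ.+ toℚᵘ (fromℚᵘ q)  ≈⟨ toℚᵘ-homo-+ (fromℚᵘ p) (fromℚᵘ q) ⟨
  toℚᵘ (fromℚᵘ p + fromℚᵘ q)             ∎)
  where open ℚᵘP.≃-Reasoning

fromℚᵘ-homo-* : ∀ p q → fromℚᵘ (p ℚᵘ.* q) ≡ fromℚᵘ p * fromℚᵘ q
fromℚᵘ-homo-* p q = toℚᵘ-injective (begin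
  toℚᵘ (fromℚᵘ (p ℚᵘ.* q))               ≈⟨ toℚᵘ-fromℚᵘ _ ⟩
  p ℚᵘ.* q                               ≈⟨ ℚᵘP.*-cong (toℚᵘ-fromℚᵘ p) (toℚᵘ-fromℚᵘ q) ⟨
  toℚᵘ (fromℚᵘ p) ℚᵘ.* toℚᵘ (fromℚᵘ q)  ≈⟨ toℚᵘ-homo-* (fromℚᵘ p) (fromℚᵘ q) ⟨
  toℚᵘ (fromℚᵘ p * fromℚᵘ q)             ∎)
  where open ℚᵘP.≃-Reasoning

ℕtoℚ-+ : ∀ m n → ℕtoℚ (m ℕ.+ n) ≡ ℕtoℚ m + ℕtoℚ n
ℕtoℚ-+ m n = trans
  (fromℚᵘ-cong {mkℚᵘ (+ (m ℕ.+ n)) 0} {mkℚᵘ (+ m) 0 ℚᵘ.+ mkℚᵘ (+ n) 0}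
    (*≡* (trans (cong (ℤ._* + 1) (ℤP.pos-+ m n)) (*1-distrib (+ m) (+ n)))))
  (fromℚᵘ-homo-+ (mkℚᵘ (+ m) 0) (mkℚᵘ (+ n) 0))
  where
  *1-distrib : ∀ x y → (x ℤ.+ y) ℤ.* (+ 1 ℤ.* + 1) ≡ (x ℤ.* + 1 ℤ.+ y ℤ.* + 1) ℤ.* + 1
  *1-distrib = ℤSolver.solve-∀

ℕtoℚ-* : ∀ m n → ℕtoℚ (m ℕ.* n) ≡ ℕtoℚ m * ℕtoℚ n
ℕtoℚ-* m n = trans
  (fromℚᵘ-cong {mkℚᵘ (+ (m ℕ.* n)) 0} {mkℚᵘ (+ m) 0 ℚᵘ.* mkℚᵘ (+ n) 0}
    (*≡* (cong (ℤ._* + 1) (ℤP.pos-* m n))))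
  (fromℚᵘ-homo-* (mkℚᵘ (+ m) 0) (mkℚᵘ (+ n) 0))

1/suc*suc≡1 : ∀ n → (+ 1 / suc n) * ℕtoℚ (suc n) ≡ 1ℚ
1/suc*suc≡1 n = trans
  (sym (fromℚᵘ-homo-* (mkℚᵘ (+ 1) n) (mkℚᵘ (+ suc n) 0)))
  (fromℚᵘ-cong {mkℚᵘ (+ 1) n ℚᵘ.* mkℚᵘ (+ suc n) 0} {mkℚᵘ (+ 1) 0}
    (*≡* (ℤP.*-assoc (+ 1) (+ suc n) (+ 1))))

x≡y-x⇒x≡½y : ∀ {x y} → x ≡ y + - x → x ≡ ½ * y
x≡y-x⇒x≡½y {x} {y} eq = begin
  x                  ≡⟨ solve 1 (λ x → x := con ½ :* (x :+ x)) refl x ⟩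
  ½ * (x + x)        ≡⟨ cong (λ z → ½ * (z + x)) eq ⟩
  ½ * (y + - x + x)  ≡⟨ solve 2 (λ x y → con ½ :* (y :+ :- x :+ x) := con ½ :* y) refl x y ⟩
  ½ * y              ∎
  where open ≡-Reasoning

x≡-x⇒x≡0 : ∀ {x} → x ≡ - x → x ≡ 0ℚ
x≡-x⇒x≡0 {x} eq = x≡y-x⇒x≡½y (trans eq (sym (ℚP.+-identityˡ (- x))))

nonpos+x≤x : ∀ {y} x → y ≤ 0ℚ → y + x ≤ x
nonpos+x≤x {y} x y≤0 = subst (y + x ≤_) (ℚP.+-identityˡ x) (ℚP.+-monoˡ-≤ x y≤0)

x≤nonneg+x : ∀ {y} x → 0ℚ ≤ y → x ≤ y + x
x≤nonneg+x {y} x 0≤y = subst (_≤ y + x) (ℚP.+-identityˡ x) (ℚP.+-monoˡ-≤ x 0≤y)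

module _ {A : Set} {_∼_ : Rel A 0ℓ} (∼-refl : Reflexive _∼_) (∼-trans : Transitive _∼_)
         {f : ℕ → A} {h : ℕ} (step : ∀ j → j ℕ.< h → f j ∼ f (suc j)) where

  chain : ∀ {i j} → i ℕ.≤ j → j ℕ.≤ h → f i ∼ f j
  chain {j = zero} z≤n _ = ∼-refl
  chain {i} {suc j} i≤1+j 1+j≤h with ℕP.m≤n⇒m<n∨m≡n i≤1+j
  ... | inj₁ (s≤s i≤j) = ∼-trans (chain i≤j (ℕP.<⇒≤ 1+j≤h)) (step j 1+j≤h)
  ... | inj₂ refl      = ∼-refl

Increasing Decreasing : (ℕ → ℚ) → ℕ → Set
Increasing f h = ∀ j → j ℕ.< h → f j ≤ f (suc j)
Decreasing f h = ∀ j → j ℕ.< h → f (suc j) ≤ f j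

module _ {f : ℕ → ℚ} {h : ℕ} where

  increasing⇒first≤ : Increasing f h → ∀ {j} → j ℕ.≤ h → f 0 ≤ f j
  increasing⇒first≤ inc = chain {_∼_ = _≤_} ℚP.≤-refl ℚP.≤-trans {f = f} inc z≤n

  increasing⇒≤last : Increasing f h → ∀ {j} → j ℕ.≤ h → f j ≤ f h
  increasing⇒≤last inc j≤h = chain {_∼_ = _≤_} ℚP.≤-refl ℚP.≤-trans {f = f} inc j≤h ℕP.≤-refl

  decreasing⇒≤first : Decreasing f h → ∀ {j} → j ℕ.≤ h → f j ≤ f 0
  decreasing⇒≤first dec = chain {_∼_ = flip _≤_} ℚP.≤-refl (flip ℚP.≤-trans) {f = f} dec z≤n

  decreasing⇒last≤ : Decreasing f h → ∀ {j} → j ℕ.≤ h → f h ≤ f j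
  decreasing⇒last≤ dec j≤h = chain {_∼_ = flip _≤_} ℚP.≤-refl (flip ℚP.≤-trans) {f = f} dec j≤h ℕP.≤-refl

m+n≡o⇒m≤o : ∀ {m n o} → m ℕ.+ n ≡ o → m ℕ.≤ o
m+n≡o⇒m≤o {m} {n} refl = m≤m+n m n

m+n≡o⇒n≤o : ∀ {m n o} → m ℕ.+ n ≡ o → n ℕ.≤ o
m+n≡o⇒n≤o {m} {n} refl = m≤n+m n m

[m+n]+[m+n]≡[m+m]+[n+n] : ∀ m n → (m ℕ.+ n) ℕ.+ (m ℕ.+ n) ≡ (m ℕ.+ m) ℕ.+ (n ℕ.+ n)
[m+n]+[m+n]≡[m+m]+[n+n] = ℕSolver.solve-∀

∑ : ℕ → (ℕ → ℚ) → ℚ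
∑ n f = Σℚ (applyUpTo f n)

∑-upTo : ∀ n f → Σℚ (map f (upTo n)) ≡ ∑ n f
∑-upTo n f = cong Σℚ (map-applyUpTo (λ i → i) f n)

∑-cong : ∀ n {f g} → (∀ {i} → i ℕ.< n → f i ≡ g i) → ∑ n f ≡ ∑ n g
∑-cong zero    f≗g = refl
∑-cong (suc n) f≗g = cong₂ _+_ (f≗g (s≤s z≤n)) (∑-cong n (f≗g ∘ s≤s))

∑-+ : ∀ n f g → ∑ n (λ i → f i + g i) ≡ ∑ n f + ∑ n g
∑-+ zero    f g = refl
∑-+ (suc n) f g = trans (cong (_+_ (f 0 + g 0)) (∑-+ n (f ∘ suc) (g ∘ suc)))
  (solve 4 (λ a b c d → (a :+ b) :+ (c :+ d) := (a :+ c) :+ (b :+ d)) refl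
    (f 0) (g 0) (∑ n (f ∘ suc)) (∑ n (g ∘ suc)))

∑-*ˡ : ∀ n c f → ∑ n (λ i → c * f i) ≡ c * ∑ n f
∑-*ˡ zero    c f = sym (ℚP.*-zeroʳ c)
∑-*ˡ (suc n) c f = trans (cong (_+_ (c * f 0)) (∑-*ˡ n c (f ∘ suc)))
  (sym (ℚP.*-distribˡ-+ c (f 0) (∑ n (f ∘ suc))))

∑-last : ∀ n f → ∑ (suc n) f ≡ ∑ n f + f n
∑-last zero    f = ℚP.+-comm (f 0) 0ℚ
∑-last (suc n) f = trans (cong (_+_ (f 0)) (∑-last n (f ∘ suc)))
  (sym (ℚP.+-assoc (f 0) (∑ n (f ∘ suc)) (f (suc n))))

-- The binomial transform

[1+k]*[1+n]C[1+k]≡[1+n]*nCk : ∀ n k → suc k ℕ.* (suc n C suc k) ≡ suc n ℕ.* (n C k)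
[1+k]*[1+n]C[1+k]≡[1+n]*nCk zero    zero    = refl
[1+k]*[1+n]C[1+k]≡[1+n]*nCk zero    (suc k) = ℕP.*-zeroʳ (suc (suc k))
[1+k]*[1+n]C[1+k]≡[1+n]*nCk (suc n) zero    =
  trans (ℕP.+-identityʳ (suc (suc n) C 1)) (trans (nC1≡n (suc (suc n))) (sym (ℕP.*-identityʳ (suc (suc n)))))
[1+k]*[1+n]C[1+k]≡[1+n]*nCk (suc n) (suc k) = begin
  suc (suc k) ℕ.* (suc (suc n) C suc (suc k))
    ≡⟨ cong (suc (suc k) ℕ.*_) (nCk+nC[k+1]≡[n+1]C[k+1] (suc n) (suc k)) ⟨
  suc (suc k) ℕ.* (X ℕ.+ Y)
    ≡⟨ regroup k X Y ⟩
  suc k ℕ.* X ℕ.+ suc (suc k) ℕ.* Y ℕ.+ X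
    ≡⟨ cong₂ (λ p q → p ℕ.+ q ℕ.+ X) ([1+k]*[1+n]C[1+k]≡[1+n]*nCk n k) ([1+k]*[1+n]C[1+k]≡[1+n]*nCk n (suc k)) ⟩
  suc n ℕ.* (n C k) ℕ.+ suc n ℕ.* (n C suc k) ℕ.+ X
    ≡⟨ cong (ℕ._+ X) (ℕP.*-distribˡ-+ (suc n) (n C k) (n C suc k)) ⟨
  suc n ℕ.* (n C k ℕ.+ n C suc k) ℕ.+ X
    ≡⟨ cong (λ z → suc n ℕ.* z ℕ.+ X) (nCk+nC[k+1]≡[n+1]C[k+1] n k) ⟩
  suc n ℕ.* X ℕ.+ X
    ≡⟨ ℕP.+-comm (suc n ℕ.* X) X ⟩
  suc (suc n) ℕ.* X ∎
  where
  open ≡-Reasoning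
  X = suc n C suc k
  Y = suc n C suc (suc k)
  regroup : ∀ m x y → suc (suc m) ℕ.* (x ℕ.+ y) ≡ suc m ℕ.* x ℕ.+ suc (suc m) ℕ.* y ℕ.+ x
  regroup = ℕSolver.solve-∀

[1+p]x≡[1+q]y⇒x/[1+q]≡y/[1+p] : ∀ p q {x y} → suc p ℕ.* x ≡ suc q ℕ.* y →
  (+ 1 / suc q) * ℕtoℚ x ≡ (+ 1 / suc p) * ℕtoℚ y
[1+p]x≡[1+q]y⇒x/[1+q]≡y/[1+p] p q {x} {y} px≡qy = begin
  V * ℕtoℚ x
    ≡⟨ ℚP.*-identityʳ (V * ℕtoℚ x) ⟨
  V * ℕtoℚ x * 1ℚ
    ≡⟨ cong (V * ℕtoℚ x *_) (1/suc*suc≡1 p) ⟨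
  V * ℕtoℚ x * (U * ℕtoℚ (suc p))
    ≡⟨ solve 4 (λ v x′ u p′ → v :* x′ :* (u :* p′) := v :* u :* (p′ :* x′)) refl V (ℕtoℚ x) U (ℕtoℚ (suc p)) ⟩
  V * U * (ℕtoℚ (suc p) * ℕtoℚ x)
    ≡⟨ cong (V * U *_) (trans (sym (ℕtoℚ-* (suc p) x)) (trans (cong ℕtoℚ px≡qy) (ℕtoℚ-* (suc q) y))) ⟩
  V * U * (ℕtoℚ (suc q) * ℕtoℚ y)
    ≡⟨ solve 4 (λ v u q′ y′ → v :* u :* (q′ :* y′) := u :* y′ :* (v :* q′)) refl V U (ℕtoℚ (suc q)) (ℕtoℚ y) ⟩
  U * ℕtoℚ y * (V * ℕtoℚ (suc q))
    ≡⟨ cong (U * ℕtoℚ y *_) (1/suc*suc≡1 q) ⟩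
  U * ℕtoℚ y * 1ℚ
    ≡⟨ ℚP.*-identityʳ (U * ℕtoℚ y) ⟩
  U * ℕtoℚ y ∎
  where
  open ≡-Reasoning
  U = + 1 / suc p
  V = + 1 / suc q

binomialTransform : (ℕ → ℚ) → ℕ → ℚ
binomialTransform c N = ∑ (suc N) (λ i → ℕtoℚ (N C i) * c i)

binomialTransform-cong : ∀ N {c c′} → (∀ i → c i ≡ c′ i) → binomialTransform c N ≡ binomialTransform c′ N
binomialTransform-cong N {c} c≗c′ = ∑-cong (suc N) λ {i} _ → cong (ℕtoℚ (N C i) *_) (c≗c′ i)

binomialTransform-zero : ∀ c → binomialTransform c 0 ≡ c 0
binomialTransform-zero c = solve 1 (λ x → con 1ℚ :* x :+ con 0ℚ := x) refl (c 0)

binomialTransform-suc : ∀ c N → binomialTransform c (suc N) ≡ binomialTransform c N + binomialTransform (c ∘ suc) N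
binomialTransform-suc c N = begin
  c₀ + ∑ (suc N) (λ i → ℕtoℚ (suc N C suc i) * c (suc i))
    ≡⟨ cong (_+_ c₀) (trans (∑-cong (suc N) λ {i} _ → pascal i) (∑-+ (suc N) P Q)) ⟩
  c₀ + (∑ (suc N) P + ∑ (suc N) Q)
    ≡⟨ cong (λ z → c₀ + (∑ (suc N) P + z)) (trans (∑-last N Q) (cong (_+_ (∑ N Q)) Q-last)) ⟩
  c₀ + (∑ (suc N) P + (∑ N Q + 0ℚ))
    ≡⟨ solve 3 (λ x y z → x :+ (y :+ (z :+ con 0ℚ)) := (x :+ z) :+ y) refl c₀ (∑ (suc N) P) (∑ N Q) ⟩
  c₀ + ∑ N Q + ∑ (suc N) P ∎
  where
  open ≡-Reasoning
  c₀ = ℕtoℚ (N C 0) * c 0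
  P Q : ℕ → ℚ
  P i = ℕtoℚ (N C i) * c (suc i)
  Q i = ℕtoℚ (N C suc i) * c (suc i)
  pascal : ∀ i → ℕtoℚ (suc N C suc i) * c (suc i) ≡ P i + Q i
  pascal i = begin
    ℕtoℚ (suc N C suc i) * c (suc i)
      ≡⟨ cong (λ z → ℕtoℚ z * c (suc i)) (nCk+nC[k+1]≡[n+1]C[k+1] N i) ⟨
    ℕtoℚ (N C i ℕ.+ N C suc i) * c (suc i)
      ≡⟨ cong (_* c (suc i)) (ℕtoℚ-+ (N C i) (N C suc i)) ⟩
    (ℕtoℚ (N C i) + ℕtoℚ (N C suc i)) * c (suc i)
      ≡⟨ ℚP.*-distribʳ-+ (c (suc i)) (ℕtoℚ (N C i)) (ℕtoℚ (N C suc i)) ⟩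
    P i + Q i ∎
  Q-last : Q N ≡ 0ℚ
  Q-last = trans (cong (λ z → ℕtoℚ z * c (suc N)) (k>n⇒nCk≡0 (ℕP.n<1+n N))) (ℚP.*-zeroˡ (c (suc N)))

weighted : (ℕ → ℚ) → ℕ → ℚ
weighted b k = (+ 1 / suc k) * b k

Recurrence : (ℕ → ℚ) → ℕ → Set
Recurrence b d = b d ≡ - (½ * ∑ d (λ k → b k * ℕtoℚ (suc d C suc k)))

binomialTransform-reflect : ∀ b d → Recurrence b d → binomialTransform (weighted b) d ≡ - weighted b d
binomialTransform-reflect b d rec = begin
  ∑ (suc d) (λ i → ℕtoℚ (d C i) * weighted b i)
    ≡⟨ ∑-cong (suc d) (λ {i} _ → absorb i) ⟩
  ∑ (suc d) (λ i → u * H i)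
    ≡⟨ ∑-*ˡ (suc d) u H ⟩
  u * ∑ (suc d) H
    ≡⟨ cong (u *_) (∑-last d H) ⟩
  u * (∑ d H + H d)
    ≡⟨ cong₂ (λ x y → u * (x + y)) sum-below (cong (λ z → b d * ℕtoℚ z) (nCn≡1 (suc d))) ⟩
  u * (- (b d + b d) + b d * 1ℚ)
    ≡⟨ solve 2 (λ u x → u :* (:- (x :+ x) :+ x :* con 1ℚ) := :- (u :* x)) refl u (b d) ⟩
  - (u * b d) ∎
  where
  open ≡-Reasoning
  u = + 1 / suc d
  H : ℕ → ℚ
  H k = b k * ℕtoℚ (suc d C suc k)
  absorb : ∀ i → ℕtoℚ (d C i) * weighted b i ≡ u * H i
  absorb i = begin
    ℕtoℚ (d C i) * ((+ 1 / suc i) * b i)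
      ≡⟨ solve 3 (λ c w x → c :* (w :* x) := (w :* c) :* x) refl (ℕtoℚ (d C i)) (+ 1 / suc i) (b i) ⟩
    (+ 1 / suc i) * ℕtoℚ (d C i) * b i
      ≡⟨ cong (_* b i) ([1+p]x≡[1+q]y⇒x/[1+q]≡y/[1+p] i d ([1+k]*[1+n]C[1+k]≡[1+n]*nCk d i)) ⟨
    u * ℕtoℚ (suc d C suc i) * b i
      ≡⟨ solve 3 (λ u c x → u :* c :* x := u :* (x :* c)) refl u (ℕtoℚ (suc d C suc i)) (b i) ⟩
    u * H i ∎
  sum-below : ∑ d H ≡ - (b d + b d)
  sum-below = begin
    ∑ d H
      ≡⟨ solve 1 (λ x → x := :- (:- (con ½ :* x) :+ :- (con ½ :* x))) refl (∑ d H) ⟩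
    - (- (½ * ∑ d H) + - (½ * ∑ d H))
      ≡⟨ cong (λ z → - (z + z)) rec ⟨
    - (b d + b d) ∎

sM-binomialTransform : ∀ a j d → sM a j d ≡ binomialTransform (λ i → weighted (bM a) (j ℕ.+ i)) (d ∸ j)
sM-binomialTransform a j d = trans (∑-upTo (suc (d ∸ j)) summand) (∑-cong (suc (d ∸ j)) term)
  where
  summand : ℕ → ℚ
  summand i = (+ 1 / suc (j ℕ.+ i)) * ℕtoℚ ((d ∸ j) C (d ∸ (j ℕ.+ i))) * bM a (j ℕ.+ i)
  term : ∀ {i} → i ℕ.< suc (d ∸ j) → summand i ≡ ℕtoℚ ((d ∸ j) C i) * weighted (bM a) (j ℕ.+ i)
  term {i} (s≤s i≤d∸j) rewrite sym (ℕP.∸-+-assoc d j i) | sym (nCk≡nC[n∸k] i≤d∸j) =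
    solve 3 (λ w c x → w :* c :* x := c :* (w :* x)) refl (+ 1 / suc (j ℕ.+ i)) (ℕtoℚ ((d ∸ j) C i)) (bM a (j ℕ.+ i))

sM-pascal : ∀ a {j e} → j ℕ.≤ e → sM a j (suc e) ≡ sM a j e + sM a (suc j) (suc e)
sM-pascal a {j} {e} j≤e = begin
  sM a j (suc e)                              ≡⟨ sM-binomialTransform a j (suc e) ⟩
  binomialTransform c (suc e ∸ j)             ≡⟨ cong (binomialTransform c) (ℕP.+-∸-assoc 1 j≤e) ⟩
  binomialTransform c (suc (e ∸ j))           ≡⟨ binomialTransform-suc c (e ∸ j) ⟩
  binomialTransform c (e ∸ j) + binomialTransform (c ∘ suc) (e ∸ j)
    ≡⟨ cong₂ _+_ (sym (sM-binomialTransform a j e))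
                 (trans (binomialTransform-cong (e ∸ j) λ i → cong (weighted (bM a)) (+-suc j i))
                        (sym (sM-binomialTransform a (suc j) (suc e)))) ⟩
  sM a j e + sM a (suc j) (suc e)             ∎
  where
  open ≡-Reasoning
  c : ℕ → ℚ
  c i = weighted (bM a) (j ℕ.+ i)

sM-diagonal : ∀ a d → sM a d d ≡ weighted (bM a) d
sM-diagonal a d = begin
  sM a d d                    ≡⟨ sM-binomialTransform a d d ⟩
  binomialTransform c (d ∸ d) ≡⟨ cong (binomialTransform c) (ℕP.n∸n≡0 d) ⟩
  binomialTransform c 0       ≡⟨ binomialTransform-zero c ⟩
  weighted (bM a) (d ℕ.+ 0)   ≡⟨ cong (weighted (bM a)) (ℕP.+-identityʳ d) ⟩
  weighted (bM a) d           ∎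
  where
  open ≡-Reasoning
  c : ℕ → ℚ
  c i = weighted (bM a) (d ℕ.+ i)

sM-reflect : ∀ a d → Recurrence (bM a) d → sM a 0 d ≡ - sM a d d
sM-reflect a d rec = begin
  sM a 0 d                            ≡⟨ sM-binomialTransform a 0 d ⟩
  binomialTransform (weighted (bM a)) d ≡⟨ binomialTransform-reflect (bM a) d rec ⟩
  - weighted (bM a) d                 ≡⟨ cong -_ (sM-diagonal a d) ⟨
  - sM a d d                          ∎
  where open ≡-Reasoning

lastOr-∷ʳ : ∀ d x xs → lastOr d (xs ∷ʳ x) ≡ x
lastOr-∷ʳ d x []       = refl
lastOr-∷ʳ d x (y ∷ ys) = lastOr-∷ʳ y x ys

zip-applyUpTo : ∀ {A B : Set} (f : ℕ → A) (g : ℕ → B) n →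
  zip (applyUpTo f n) (applyUpTo g n) ≡ applyUpTo (λ i → f i , g i) n
zip-applyUpTo f g zero    = refl
zip-applyUpTo f g (suc n) = cong (_ ∷_) (zip-applyUpTo (f ∘ suc) (g ∘ suc) n)

bsUpTo≡applyUpTo : ∀ a n → bsUpTo a n ≡ applyUpTo (bM a) (suc n)
bsUpTo≡applyUpTo a 0 = refl
bsUpTo≡applyUpTo a 1 = refl
bsUpTo≡applyUpTo a 2 = refl
bsUpTo≡applyUpTo a (suc (suc (suc n))) = begin
  prev ∷ʳ x                        ≡⟨ cong (_∷ʳ x) (bsUpTo≡applyUpTo a (suc (suc n))) ⟩
  applyUpTo (bM a) d ∷ʳ x          ≡⟨ cong (applyUpTo (bM a) d ∷ʳ_) (lastOr-∷ʳ 0ℚ x prev) ⟨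
  applyUpTo (bM a) d ∷ʳ bM a d     ≡⟨ applyUpTo-∷ʳ (bM a) d ⟩
  applyUpTo (bM a) (suc d)         ∎
  where
  open ≡-Reasoning
  d = 3 ℕ.+ n
  prev = bsUpTo a (2 ℕ.+ n)
  x = next d prev

-- Only b(0) and b(2) are free initial values: b(1) = -1 already satisfies the
-- recurrence, which is what makes every odd row reflect.
bM-recurrence-1 : ∀ a → Recurrence (bM a) 1
bM-recurrence-1 a = refl

bM-recurrence : ∀ a {d} → 3 ℕ.≤ d → Recurrence (bM a) d
bM-recurrence a {suc (suc (suc n))} (s≤s (s≤s (s≤s _))) = begin
  bM a d                                          ≡⟨ lastOr-∷ʳ 0ℚ (next d prev) prev ⟩
  next d prev                                     ≡⟨ cong (next d) (bsUpTo≡applyUpTo a (suc (suc n))) ⟩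
  - (½ * Σℚ (map F (zip (upTo d) (applyUpTo (bM a) d))))
    ≡⟨ cong (λ z → - (½ * Σℚ (map F z))) (zip-applyUpTo (λ i → i) (bM a) d) ⟩
  - (½ * Σℚ (map F (applyUpTo (λ i → i , bM a i) d)))
    ≡⟨ cong (λ z → - (½ * Σℚ z)) (map-applyUpTo (λ i → i , bM a i) F d) ⟩
  - (½ * ∑ d (λ k → bM a k * ℕtoℚ (suc d C suc k))) ∎
  where
  open ≡-Reasoning
  d = 3 ℕ.+ n
  prev = bsUpTo a (2 ℕ.+ n)
  F : ℕ × ℚ → ℚ
  F (k , bk) = bk * ℕtoℚ (suc d C suc k)

-- Pascal triangles

module PascalTriangle (S : ℕ → ℕ → ℚ)
  (pascal : ∀ {j e} → j ℕ.≤ e → S j (suc e) ≡ S j e + S (suc j) (suc e)) where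

  Symmetric Antisymmetric : ℕ → Set
  Symmetric d     = ∀ j k → j ℕ.+ k ≡ d → S j d ≡ S k d
  Antisymmetric d = ∀ j k → j ℕ.+ k ≡ d → S j d ≡ - S k d

  antisymmetric-suc : ∀ {e} → Symmetric e → S 0 (suc e) ≡ - S (suc e) (suc e) → Antisymmetric (suc e)
  antisymmetric-suc sym-e reflect zero    _ refl = reflect
  antisymmetric-suc {e} sym-e reflect (suc j) k j+k≡e′ = begin
    S (suc j) (suc e)
      ≡⟨ solve 2 (λ y z → z := (y :+ z) :- y) refl (S j e) (S (suc j) (suc e)) ⟩
    S j e + S (suc j) (suc e) - S j e
      ≡⟨ cong (_- S j e) (pascal (m+n≡o⇒m≤o j+k≡e)) ⟨
    S j (suc e) - S j e
      ≡⟨ cong₂ _-_ (antisymmetric-suc sym-e reflect j (suc k) (trans (+-suc j k) j+k≡e′)) (sym-e j k j+k≡e) ⟩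
    - S (suc k) (suc e) - S k e
      ≡⟨ solve 2 (λ x y → :- x :- y := :- (y :+ x)) refl (S (suc k) (suc e)) (S k e) ⟩
    - (S k e + S (suc k) (suc e))
      ≡⟨ cong -_ (pascal (m+n≡o⇒n≤o j+k≡e)) ⟨
    - S k (suc e) ∎
    where
    open ≡-Reasoning
    j+k≡e : j ℕ.+ k ≡ e
    j+k≡e = ℕP.suc-injective j+k≡e′

  -- Induction on the gap k ∸ j, closing in on the middle from both ends.
  symmetric-gap : ∀ {e} → Antisymmetric e →
    ∀ n {j k} → k ≡ n ℕ.+ j → j ℕ.+ k ≡ suc e → S j (suc e) ≡ S k (suc e)
  symmetric-gap anti zero refl _ = refl
  symmetric-gap {e} anti 1 {j} refl j+k≡1+e = begin
    S j (suc e)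
      ≡⟨ pascal (m+n≡o⇒m≤o j+j≡e) ⟩
    S j e + S (suc j) (suc e)
      ≡⟨ cong (_+ S (suc j) (suc e)) (x≡-x⇒x≡0 (anti j j j+j≡e)) ⟩
    0ℚ + S (suc j) (suc e)
      ≡⟨ ℚP.+-identityˡ _ ⟩
    S (suc j) (suc e) ∎
    where
    open ≡-Reasoning
    j+j≡e : j ℕ.+ j ≡ e
    j+j≡e = ℕP.suc-injective (trans (sym (+-suc j j)) j+k≡1+e)
  symmetric-gap {e} anti (suc (suc n)) {j} refl j+k≡1+e = begin
    S j (suc e)
      ≡⟨ pascal (m+n≡o⇒m≤o j+m≡e) ⟩
    S j e + S (suc j) (suc e)
      ≡⟨ cong₂ _+_ (anti j m j+m≡e) (symmetric-gap anti n (sym (+-suc n j)) 1+j+m≡1+e) ⟩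
    - S m e + S m (suc e)
      ≡⟨ cong (_+_ (- S m e)) (pascal (m+n≡o⇒n≤o j+m≡e)) ⟩
    - S m e + (S m e + S (suc m) (suc e))
      ≡⟨ solve 2 (λ x y → :- x :+ (x :+ y) := y) refl (S m e) (S (suc m) (suc e)) ⟩
    S (suc m) (suc e) ∎
    where
    open ≡-Reasoning
    m = suc (n ℕ.+ j)
    1+j+m≡1+e : suc (j ℕ.+ m) ≡ suc e
    1+j+m≡1+e = trans (sym (+-suc j m)) j+k≡1+e
    j+m≡e : j ℕ.+ m ≡ e
    j+m≡e = ℕP.suc-injective 1+j+m≡1+e

  symmetric-suc : ∀ {e} → Antisymmetric e → Symmetric (suc e)
  symmetric-suc anti j k j+k≡1+e with ℕP.≤-total j k
  ... | inj₁ j≤k = symmetric-gap anti (k ∸ j) (sym (ℕP.m∸n+n≡m j≤k)) j+k≡1+e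
  ... | inj₂ k≤j = sym (symmetric-gap anti (j ∸ k) (sym (ℕP.m∸n+n≡m k≤j)) (trans (ℕP.+-comm k j) j+k≡1+e))

  increasing-suc : ∀ {d h} → h ℕ.≤ suc d → (∀ j → j ℕ.< h → S j d ≤ 0ℚ) → Increasing (λ j → S j (suc d)) h
  increasing-suc {d} h≤1+d nonpos j j<h = subst (_≤ S (suc j) (suc d))
    (sym (pascal (ℕP.≤-pred (ℕP.≤-trans j<h h≤1+d)))) (nonpos+x≤x (S (suc j) (suc d)) (nonpos j j<h))

  decreasing-suc : ∀ {d h} → h ℕ.≤ suc d → (∀ j → j ℕ.< h → 0ℚ ≤ S j d) → Decreasing (λ j → S j (suc d)) h
  decreasing-suc {d} h≤1+d nonneg j j<h = subst (S (suc j) (suc d) ≤_)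
    (sym (pascal (ℕP.≤-pred (ℕP.≤-trans j<h h≤1+d)))) (x≤nonneg+x (S (suc j) (suc d)) (nonneg j j<h))

  middle-half : ∀ {d h} → h ℕ.≤ d → S (suc h) (suc d) ≡ - S h (suc d) → S h (suc d) ≡ ½ * S h d
  middle-half {d} {h} h≤d anti = x≡y-x⇒x≡½y {y = S h d} (trans (pascal h≤d) (cong (_+_ (S h d)) anti))

  middle-nonneg : ∀ {d h} → h ℕ.≤ d → S (suc h) (suc d) ≡ - S h (suc d) → 0ℚ ≤ S h d → 0ℚ ≤ S h (suc d)
  middle-nonneg {d} {h} h≤d anti 0≤S =
    subst (0ℚ ≤_) (sym (middle-half h≤d anti)) (ℚP.*-monoˡ-≤-nonNeg ½ {0ℚ} {S h d} 0≤S)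

  middle-nonpos : ∀ {d h} → h ℕ.≤ d → S (suc h) (suc d) ≡ - S h (suc d) → S h d ≤ 0ℚ → S h (suc d) ≤ 0ℚ
  middle-nonpos {d} {h} h≤d anti S≤0 =
    subst (_≤ 0ℚ) (sym (middle-half h≤d anti)) (ℚP.*-monoˡ-≤-nonNeg ½ {S h d} {0ℚ} S≤0)

a/1≤0 : ∀ {a} → a ℤ.≤ + 0 → a / 1 ≤ 0ℚ
a/1≤0 {+0}       _ = ℚP.≤-refl
a/1≤0 {+[1+ n ]}  (ℤ.+≤+ ())
a/1≤0 { -[1+ n ]} _ = ℚP.neg-antimono-≤ (ℚP.nonNegative⁻¹ _ {{ℚP.normalize-nonNeg (suc n) 1}})

module _ (a : ℤ) where

  open PascalTriangle (sM a) (sM-pascal a)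

  reflect-odd : ∀ c → sM a 0 (suc (c ℕ.+ c)) ≡ - sM a (suc (c ℕ.+ c)) (suc (c ℕ.+ c))
  reflect-odd zero    = sM-reflect a 1 (bM-recurrence-1 a)
  reflect-odd (suc c) = sM-reflect a (suc (suc c ℕ.+ suc c))
    (bM-recurrence a (s≤s (s≤s (ℕP.≤-trans (s≤s z≤n) (m≤n+m (suc c) c)))))

  symmetric-even : ∀ c → Symmetric (c ℕ.+ c)
  antisymmetric-odd : ∀ c → Antisymmetric (suc (c ℕ.+ c))

  symmetric-even zero zero zero refl = refl
  symmetric-even (suc c) = subst Symmetric (cong suc (sym (+-suc c c))) (symmetric-suc (antisymmetric-odd c))

  antisymmetric-odd c = antisymmetric-suc (symmetric-even c) (reflect-odd c)

  zero-even : ∀ c {d} → c ℕ.+ c ≡ d → 3 ℕ.≤ d → sM a 0 d ≡ 0ℚ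
  zero-even c refl 3≤d = x≡-x⇒x≡0 (trans (sM-reflect a (c ℕ.+ c) (bM-recurrence a 3≤d))
    (cong -_ (symmetric-even c (c ℕ.+ c) 0 (ℕP.+-identityʳ (c ℕ.+ c)))))

  middle-antisymmetric : ∀ c {d} → suc (c ℕ.+ c) ≡ d → sM a (suc c) d ≡ - sM a c d
  middle-antisymmetric c refl = antisymmetric-odd c (suc c) c refl

  -- For h = 2m this is row 4m + 3, nonpositive on [0, 2m + 1].
  NonPosRow : ℕ → Set
  NonPosRow h = ∀ j → j ℕ.≤ suc h → sM a j (3 ℕ.+ (h ℕ.+ h)) ≤ 0ℚ

  -- The theorem asserts FourRows (4m) (4m + 1) (4m + 2) (4m + 3) (2m) (2m + 1).
  FourRows : (d₀ d₁ d₂ d₃ h h′ : ℕ) → Set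
  FourRows d₀ d₁ d₂ d₃ h h′ =
      (0ℚ ≡ sM a 0 d₀ × Increasing (λ j → sM a j d₀) h)
    × (0ℚ ≤ sM a h d₁ × Decreasing (λ j → sM a j d₁) h)
    × (0ℚ ≡ sM a 0 d₂ × Decreasing (λ j → sM a j d₂) h′)
    × (sM a h′ d₃ ≤ 0ℚ × Increasing (λ j → sM a j d₃) h′)

  FourRows-cong : ∀ {d₀ d₁ d₂ d₃ h h′ e₀ e₁ e₂ e₃ k k′} →
    d₀ ≡ e₀ → d₁ ≡ e₁ → d₂ ≡ e₂ → d₃ ≡ e₃ → h ≡ k → h′ ≡ k′ →
    FourRows d₀ d₁ d₂ d₃ h h′ → FourRows e₀ e₁ e₂ e₃ k k′
  FourRows-cong refl refl refl refl refl refl rows = rows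

  four-rows : ∀ h → NonPosRow h →
    FourRows (4 ℕ.+ (h ℕ.+ h)) (5 ℕ.+ (h ℕ.+ h)) (6 ℕ.+ (h ℕ.+ h)) (7 ℕ.+ (h ℕ.+ h)) (2 ℕ.+ h) (3 ℕ.+ h)
  four-rows h below = (sym zero₀ , incr₀) , (mid₁ , decr₁) , (sym zero₂ , decr₂) , (mid₃ , incr₃)
    where
    d = h ℕ.+ h
    lift : ∀ {k k′} → k ℕ.≤ k′ → k ℕ.+ h ℕ.≤ k′ ℕ.+ d
    lift k≤k′ = ℕP.+-mono-≤ k≤k′ (m≤m+n h h)
    shift : ∀ k → (k ℕ.+ h) ℕ.+ (k ℕ.+ h) ≡ (k ℕ.+ k) ℕ.+ d
    shift k = [m+n]+[m+n]≡[m+m]+[n+n] k h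
    3≤ : ∀ {n} → 3 ℕ.≤ 3 ℕ.+ n
    3≤ {n} = m≤m+n 3 n

    zero₀ : sM a 0 (4 ℕ.+ d) ≡ 0ℚ
    zero₀ = zero-even (2 ℕ.+ h) (shift 2) 3≤
    incr₀ : Increasing (λ j → sM a j (4 ℕ.+ d)) (2 ℕ.+ h)
    incr₀ = increasing-suc (lift (m≤n+m 2 2)) (λ j j< → below j (ℕP.≤-pred j<))
    nonneg₀ : ∀ {j} → j ℕ.≤ 2 ℕ.+ h → 0ℚ ≤ sM a j (4 ℕ.+ d)
    nonneg₀ {j} j≤ = subst (_≤ sM a j (4 ℕ.+ d)) zero₀ (increasing⇒first≤ incr₀ j≤)

    mid₁ : 0ℚ ≤ sM a (2 ℕ.+ h) (5 ℕ.+ d)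
    mid₁ = middle-nonneg (lift (m≤n+m 2 2)) (middle-antisymmetric (2 ℕ.+ h) (cong suc (shift 2))) (nonneg₀ ℕP.≤-refl)
    decr₁ : Decreasing (λ j → sM a j (5 ℕ.+ d)) (2 ℕ.+ h)
    decr₁ = decreasing-suc (lift (m≤n+m 2 3)) (λ j j< → nonneg₀ (ℕP.<⇒≤ j<))
    nonneg₁ : ∀ {j} → j ℕ.≤ 2 ℕ.+ h → 0ℚ ≤ sM a j (5 ℕ.+ d)
    nonneg₁ j≤ = ℚP.≤-trans mid₁ (decreasing⇒last≤ decr₁ j≤)

    zero₂ : sM a 0 (6 ℕ.+ d) ≡ 0ℚ
    zero₂ = zero-even (3 ℕ.+ h) (shift 3) 3≤
    decr₂ : Decreasing (λ j → sM a j (6 ℕ.+ d)) (3 ℕ.+ h)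
    decr₂ = decreasing-suc (lift (m≤n+m 3 3)) (λ j j< → nonneg₁ (ℕP.≤-pred j<))
    nonpos₂ : ∀ {j} → j ℕ.≤ 3 ℕ.+ h → sM a j (6 ℕ.+ d) ≤ 0ℚ
    nonpos₂ {j} j≤ = subst (sM a j (6 ℕ.+ d) ≤_) zero₂ (decreasing⇒≤first decr₂ j≤)

    mid₃ : sM a (3 ℕ.+ h) (7 ℕ.+ d) ≤ 0ℚ
    mid₃ = middle-nonpos (lift (m≤n+m 3 3)) (middle-antisymmetric (3 ℕ.+ h) (cong suc (shift 3))) (nonpos₂ ℕP.≤-refl)
    incr₃ : Increasing (λ j → sM a j (7 ℕ.+ d)) (3 ℕ.+ h)
    incr₃ = increasing-suc (lift (m≤n+m 3 4)) (λ j j< → nonpos₂ (ℕP.<⇒≤ j<))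

  nonPosRow-step : ∀ h → NonPosRow h → NonPosRow (2 ℕ.+ h)
  nonPosRow-step h below j j≤ = subst (λ d → sM a j d ≤ 0ℚ) (cong (3 ℕ.+_) (sym ([m+n]+[m+n]≡[m+m]+[n+n] 2 h)))
    (ℚP.≤-trans (increasing⇒≤last incr₃ j≤) mid₃)
    where
    mid₃ : sM a (3 ℕ.+ h) (7 ℕ.+ (h ℕ.+ h)) ≤ 0ℚ
    mid₃ = proj₁ (proj₂ (proj₂ (proj₂ (four-rows h below))))
    incr₃ : Increasing (λ j → sM a j (7 ℕ.+ (h ℕ.+ h))) (3 ℕ.+ h)
    incr₃ = proj₂ (proj₂ (proj₂ (proj₂ (four-rows h below))))

  module _ (a≤0 : a ℤ.≤ + 0) where

    -- sM a 1 1 = -1/2 does not depend on a.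
    diagonal₁ : sM a 1 1 ≤ 0ℚ
    diagonal₁ = ℚP.nonPositive⁻¹ _

    diagonal₂ : sM a 2 2 ≤ 0ℚ
    diagonal₂ = subst (_≤ 0ℚ) (sym (sM-diagonal a 2)) (ℚP.*-monoˡ-≤-nonNeg (+ 1 / 3) (a/1≤0 a≤0))

    row₂-nonpos : ∀ j → j ℕ.≤ 1 → sM a j 2 ≤ 0ℚ
    row₂-nonpos 0 _ = subst (_≤ 0ℚ) (sym (symmetric-even 1 0 2 refl)) diagonal₂
    row₂-nonpos 1 _ = subst (_≤ 0ℚ) (sym (sM-pascal a {1} {1} ℕP.≤-refl)) (ℚP.+-mono-≤ diagonal₁ diagonal₂)
    row₂-nonpos (suc (suc _)) (s≤s ())

    row-nonpos : ∀ n → NonPosRow (2 ℕ.* n)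
    row-nonpos zero j j≤1 = ℚP.≤-trans (increasing⇒≤last incr j≤1) mid
      where
      incr : Increasing (λ j → sM a j 3) 1
      incr = increasing-suc (s≤s z≤n) (λ j j<1 → row₂-nonpos j (ℕP.<⇒≤ j<1))
      mid : sM a 1 3 ≤ 0ℚ
      mid = middle-nonpos {d = 2} (s≤s z≤n) (middle-antisymmetric 1 refl) (row₂-nonpos 1 ℕP.≤-refl)
    row-nonpos (suc n) = subst NonPosRow (sym (ℕP.*-suc 2 n)) (nonPosRow-step (2 ℕ.* n) (row-nonpos n))

mainTheorem12 : (a : ℤ) → a ℤ.≤ + 0 → (m : ℕ) → 1 ℕ.≤ m →
    (0ℚ ≡ sM a 0 (4 ℕ.* m)
    × (∀ j → j ℕ.< 2 ℕ.* m → sM a j (4 ℕ.* m) ℚ.≤ sM a (suc j) (4 ℕ.* m)))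
    × (0ℚ ℚ.≤ sM a (2 ℕ.* m) (4 ℕ.* m ℕ.+ 1)
    × (∀ j → j ℕ.< 2 ℕ.* m → sM a (suc j) (4 ℕ.* m ℕ.+ 1) ℚ.≤ sM a j (4 ℕ.* m ℕ.+ 1)))
    × (0ℚ ≡ sM a 0 (4 ℕ.* m ℕ.+ 2)
    × (∀ j → j ℕ.< 2 ℕ.* m ℕ.+ 1 → sM a (suc j) (4 ℕ.* m ℕ.+ 2) ℚ.≤ sM a j (4 ℕ.* m ℕ.+ 2)))
    × (sM a (2 ℕ.* m ℕ.+ 1) (4 ℕ.* m ℕ.+ 3) ℚ.≤ 0ℚ
    × (∀ j → j ℕ.< 2 ℕ.* m ℕ.+ 1 → sM a j (4 ℕ.* m ℕ.+ 3) ℚ.≤ sM a (suc j) (4 ℕ.* m ℕ.+ 3)))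
mainTheorem12 a a≤0 (suc n) _ =
  FourRows-cong a (e₀ n) (e₁ n) (e₂ n) (e₃ n) (e n) (e′ n) (four-rows a (2 ℕ.* n) (row-nonpos a a≤0 n))
  where
  e₀ : ∀ n → 4 ℕ.+ (2 ℕ.* n ℕ.+ 2 ℕ.* n) ≡ 4 ℕ.* suc n
  e₀ = ℕSolver.solve-∀
  e₁ : ∀ n → 5 ℕ.+ (2 ℕ.* n ℕ.+ 2 ℕ.* n) ≡ 4 ℕ.* suc n ℕ.+ 1
  e₁ = ℕSolver.solve-∀
  e₂ : ∀ n → 6 ℕ.+ (2 ℕ.* n ℕ.+ 2 ℕ.* n) ≡ 4 ℕ.* suc n ℕ.+ 2
  e₂ = ℕSolver.solve-∀
  e₃ : ∀ n → 7 ℕ.+ (2 ℕ.* n ℕ.+ 2 ℕ.* n) ≡ 4 ℕ.* suc n ℕ.+ 3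
  e₃ = ℕSolver.solve-∀
  e : ∀ n → 2 ℕ.+ 2 ℕ.* n ≡ 2 ℕ.* suc n
  e = ℕSolver.solve-∀
  e′ : ∀ n → 3 ℕ.+ 2 ℕ.* n ≡ 2 ℕ.* suc n ℕ.+ 1
  e′ = ℕSolver.solve-∀
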